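{- Let $G=(V,E)$ be the complete graph on $n$ vertices with a positive self-loop at every vertex, where every edge is labelled $+$ or $-$. Let $C=(C_1,\dots,C_k)$ be any partition of $V$ into clusters, with disagreement vector $y$. For any $u\in V$ and any $v\in N_u^+\cap C(u)$, \[ |N_u^+\cap N_v^-| + |N_u^-\cap N_v^+| \le y(u)+y(v). \]
   Context: $E^+$ and $E^-$ denote the sets of positive and negative edges, and every vertex $v$ has a positive self-loop $(v,v)\in E^+$. For $u\in V$, $N_u^+=\{v\in V:(u,v)\in E^+\}$ and $N_u^-=\{v\in V:(u,v)\in E^-\}$; thus $u\in N_u^+$. $C(u)$ denotes the cluster containing $u$. An edge $(u,v)$ is in disagreement with respect to a clustering if it is positive and $u,v$ lie in different clusters, or it is negative and $u,v$ lie in the same cluster. The disagreement vector $y\in\mathbb{Z}_{\ge0}^V$ is given by $y(u)=$ the number of edges incident to $u$ that are in disagreement. Self-loops are never in disagreement. -}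

module Defs where

open import Data.Nat using (ℕ; _+_)
open import Data.Bool using (Bool; true; false; not; _∧_; _xor_; if_then_else_)
open import Data.Fin using (Fin; _≟_)
open import Data.List using (List; length; filter)
open import Data.List using () renaming (allFin to allFinL)
open import Data.Bool.Properties using (T?)
open import Relation.Nullary.Decidable using (⌊_⌋)
open import Relation.Binary.PropositionalEquality using (_≡_)

-- A signed complete graph on vertex set Fin n: sign u v = true means (u,v) ∈ E⁺,
-- false means (u,v) ∈ E⁻.  Every pair (including u = v) gets exactly one label.
record SignedComplete (n : ℕ) : Set where
  field
    sign     : Fin n → Fin n → Bool
    symmetric : ∀ u v → sign u v ≡ sign v u
    selfLoop  : ∀ u → sign u u ≡ true
open SignedComplete public

Clustering : ℕ → ℕ → Set
Clustering n k = Fin n → Fin k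

count : ∀ {n} → (Fin n → Bool) → ℕ
count {n} p = length (filter (λ v → T? (p v)) (allFinL n))

sameCluster : ∀ {n k} → Clustering n k → Fin n → Fin n → Bool
sameCluster C u v = ⌊ C u ≟ C v ⌋

inPos : ∀ {n} → SignedComplete n → Fin n → Fin n → Bool
inPos G u v = sign G u v

inNeg : ∀ {n} → SignedComplete n → Fin n → Fin n → Bool
inNeg G u v = not (sign G u v)

-- (u,v) is in disagreement: positive and split, or negative and together.
-- (Self-loops are positive and never split, so they are never in disagreement.)
disagree : ∀ {n k} → SignedComplete n → Clustering n k → Fin n → Fin n → Bool
disagree G C u v = if sign G u v then not (sameCluster C u v) else sameCluster C u v

y : ∀ {n k} → SignedComplete n → Clustering n k → Fin n → ℕ
y G C u = count (disagree G C u)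

{-# OPTIONS --safe #-}
-- Since u and v lie in the same cluster, any third vertex w is either together
-- with both of them or separated from both.  If the edges uw and vw carry
-- different signs, then in either case exactly one of them is in disagreement,
-- so every w counted on the left is charged to y(u) + y(v).
module Submission where

open import Defs
open import Data.Nat using (ℕ; _+_; _≤_; z≤n; s≤s)
open import Data.Nat.Properties using (+-mono-≤; +-commutativeSemigroup)
open import Algebra.Properties.CommutativeSemigroup +-commutativeSemigroup
  using (interchange)
open import Data.Bool using (Bool; true; false; _∧_; not; if_then_else_)
open import Data.Bool.Properties using (T?)
open import Data.Fin using (Fin; _≟_)
open import Data.List using (List; []; _∷_; length; filter; allFin)
open import Relation.Nullary.Decidable using (yes; no)
open import Relation.Binary.PropositionalEquality using (_≡_; refl; subst₂)

boolToℕ : Bool → ℕ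
boolToℕ true  = 1
boolToℕ false = 0

countIn : ∀ {a} {A : Set a} → (A → Bool) → List A → ℕ
countIn p xs = length (filter (λ x → T? (p x)) xs)

countIn-∷ : ∀ {a} {A : Set a} (p : A → Bool) x xs →
            countIn p (x ∷ xs) ≡ boolToℕ (p x) + countIn p xs
countIn-∷ p x xs with p x
... | true  = refl
... | false = refl

countIn-mono₂ : ∀ {a} {A : Set a} (p q r s : A → Bool) →
                (∀ x → boolToℕ (p x) + boolToℕ (q x) ≤ boolToℕ (r x) + boolToℕ (s x)) →
                ∀ xs → countIn p xs + countIn q xs ≤ countIn r xs + countIn s xs
countIn-mono₂ p q r s pointwise []       = z≤n
countIn-mono₂ p q r s pointwise (x ∷ xs)
  rewrite countIn-∷ p x xs | countIn-∷ q x xs | countIn-∷ r x xs | countIn-∷ s x xs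
  = subst₂ _≤_ (interchange (boolToℕ (p x)) (boolToℕ (q x)) (countIn p xs) (countIn q xs))
                (interchange (boolToℕ (r x)) (boolToℕ (s x)) (countIn r xs) (countIn s xs))
      (+-mono-≤ (pointwise x) (countIn-mono₂ p q r s pointwise xs))

-- a, b: signs of uw and vw; together: whether w shares the cluster of u and v.
signsDiffer≤disagreements : ∀ a b together →
  boolToℕ (a ∧ not b) + boolToℕ (not a ∧ b)
    ≤ boolToℕ (if a then not together else together)
      + boolToℕ (if b then not together else together)
signsDiffer≤disagreements true  true  _     = z≤n
signsDiffer≤disagreements true  false true  = s≤s z≤n
signsDiffer≤disagreements true  false false = s≤s z≤n
signsDiffer≤disagreements false true  true  = s≤s z≤n
signsDiffer≤disagreements false true  false = s≤s z≤n
signsDiffer≤disagreements false false _     = z≤n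

sameCluster-substˡ : ∀ {n k} (C : Clustering n k) {u v} → sameCluster C u v ≡ true →
                     ∀ w → sameCluster C v w ≡ sameCluster C u w
sameCluster-substˡ C {u} {v} uv w with C u ≟ C v
... | yes Cu≡Cv rewrite Cu≡Cv = refl
sameCluster-substˡ C () w | no _

proposition1 : ∀ {n k} (G : SignedComplete n) (C : Clustering n k) (u v : Fin n) →
    inPos G u v ≡ true → sameCluster C u v ≡ true →
    count (λ w → inPos G u w ∧ inNeg G v w) + count (λ w → inNeg G u w ∧ inPos G v w)
      ≤ y G C u + y G C v
proposition1 {n} G C u v _ sameUV = countIn-mono₂ _ _ _ _ pointwise (allFin n)
  where
  pointwise : ∀ w → boolToℕ (inPos G u w ∧ inNeg G v w) + boolToℕ (inNeg G u w ∧ inPos G v w)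
                    ≤ boolToℕ (disagree G C u w) + boolToℕ (disagree G C v w)
  pointwise w rewrite sameCluster-substˡ C sameUV w =
    signsDiffer≤disagreements (sign G u w) (sign G v w) (sameCluster C u w)
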